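{- The following are equivalent: (a) for every integer $n>2$, $n$ does not divide $!n$; (b) for every prime $p>2$, $\left[\frac{(p-1)!}{e}\right]\not\equiv -1 \pmod p$, where $[x]$ denotes the integer part of $x$.
   Context: For a positive integer $n$, the left factorial is $!n=\sum_{i=0}^{n-1} i!$; $e$ is the base of the natural logarithm. -}

module Defs where

open import Data.Nat as ℕ using (ℕ; zero; suc; _!)
open import Data.Nat.Properties using (_!≢0)
open import Data.List using (map; upTo)
open import Data.Nat.ListAction using (sum)
open import Data.Integer using (+_)
open import Data.Rational as ℚ using (ℚ; _/_; 0ℚ)
open import Data.Product using (∃)

leftFactorial : ℕ → ℕ
leftFactorial n = sum (map _! (upTo n))

ePartial : ℕ → ℚ
ePartial zero = 0ℚ
ePartial (suc n) = ePartial n ℚ.+ (_/_ (+ 1) (n !) {{n !≢0}})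

-- IsFloorDivE N k  means  k = [N / e], i.e.  k·e ≤ N < (k+1)·e,
-- with e = sup of the (increasing) partial sums eₙ:
--   k·e ≤ N   ⇔  ∀ n, k·eₙ ≤ N
--   N < (k+1)·e ⇔ ∃ n, N < (k+1)·eₙ
IsFloorDivE : ℕ → ℕ → Set
IsFloorDivE N k =
  ((n : ℕ) → (+ k / 1) ℚ.* ePartial n ℚ.≤ (+ N / 1)) Data.Product.×
  ∃ (λ n → (+ N / 1) ℚ.< (+ suc k / 1) ℚ.* ePartial n)

-- An odd prime p = 2h + 1 suffices on both sides: !n ≡ 2 (mod 4) for n ≥ 4, and !n ≡ !d (mod d)
-- whenever d ≤ n, so a counterexample n > 2 to (a) has an odd prime factor p with p ∣ !p.
-- For even a = p - 1 one has [a!/e] + 1 = D(a), the number of derangements of a points, and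
-- D(a) = Σ_{j ≤ a} (-1)^{a-j} a(a-1)⋯(a-j+1); evaluating this polynomial at -1 ≡ a (mod p) gives
-- Σ_{j ≤ a} j! = !p, so p ∣ [a!/e] + 1 iff p ∣ !p. The floor is computed from the alternating-series
-- bounds on the partial sums of 1/e and the identity Σ_{i + j ≤ M} (-1)^i / (i! j!) = 1.

module Submission where

open import Defs
open import Data.Nat as ℕ using (ℕ; zero; suc; _+_; _*_; _∸_; _<_; _≤_; _!; z≤n; s≤s)
import Data.Nat.Properties as ℕP
open import Data.Nat.Properties using (_!≢0)
open import Data.Nat.Divisibility
  using (_∣_; divides; ∣-trans; m≤n⇒m!∣n!; m∣m*n; n∣m*n; ∣m+n∣m⇒∣n; ∣⇒≤; _∣?_)
open import Data.Nat.Divisibility.Core using (hasNonTrivialDivisor)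
open import Data.Nat.ListAction using (sum; product)
open import Data.Nat.ListAction.Properties using (sum-++)
open import Data.Nat.Primality using (Prime; prime⇒nonTrivial; prime⇒nonZero)
open import Data.Nat.Primality.Factorisation using (factorise)
open import Data.Nat.Coprimality using (1-coprimeTo) renaming (sym to coprime-sym)
open import Data.List using ([]; _∷_; [_]; _++_; map; upTo)
open import Data.List.Properties using (upTo-∷ʳ; map-++)
open import Data.List.Relation.Unary.All using (_∷_)
open import Data.Integer as ℤ using (ℤ; +_; 0ℤ; 1ℤ; -1ℤ; _^_)
import Data.Integer.Properties as ℤP
import Data.Integer.Divisibility.Signed as ℤ∣
open import Data.Integer.Solver using () renaming (module +-*-Solver to ℤ-Solver)
open import Data.Rational as ℚ using (ℚ; _/_; 0ℚ; 1ℚ; mkℚ)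
import Data.Rational.Properties as ℚP
open import Data.Rational.Unnormalised as ℚᵘ using (mkℚᵘ)
import Data.Rational.Unnormalised.Properties as ℚᵘP
open import Data.Rational.Solver using () renaming (module +-*-Solver to ℚ-Solver)
open import Data.Product using (_,_; _×_; ∃-syntax)
open import Data.Sum using (_⊎_; inj₁; inj₂)
open import Function using (_∘_; flip)
open import Function.Bundles using (_⇔_; mk⇔; Equivalence)
open import Relation.Binary.Definitions using (Reflexive; Transitive)
open import Relation.Nullary using (¬_; contradiction)
open import Relation.Nullary.Decidable using (toWitnessFalse)
open import Relation.Binary.PropositionalEquality
  using (_≡_; refl; sym; trans; cong; cong₂; subst; subst₂; module ≡-Reasoning)

leftFactorial-suc : ∀ n → leftFactorial (suc n) ≡ leftFactorial n + n !
leftFactorial-suc n = begin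
  sum (map _! (upTo (suc n)))        ≡⟨ cong (sum ∘ map _!) (upTo-∷ʳ n) ⟨
  sum (map _! (upTo n ++ [ n ]))     ≡⟨ cong sum (map-++ _! (upTo n) [ n ]) ⟩
  sum (map _! (upTo n) ++ [ n ! ])   ≡⟨ sum-++ (map _! (upTo n)) [ n ! ] ⟩
  leftFactorial n + (n ! + 0)        ≡⟨ cong (λ k → leftFactorial n + k) (ℕP.+-identityʳ (n !)) ⟩
  leftFactorial n + n !              ∎
  where open ≡-Reasoning

n∣[n+t]! : ∀ n t .{{_ : ℕ.NonZero n}} → n ∣ (n + t) !
n∣[n+t]! (suc k) t = ∣-trans (m∣m*n (k !)) (m≤n⇒m!∣n! (ℕP.m≤m+n (suc k) t))

∣leftFactorial[+]⇒∣leftFactorial : ∀ d t .{{_ : ℕ.NonZero d}} →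
                                  d ∣ leftFactorial (d + t) → d ∣ leftFactorial d
∣leftFactorial[+]⇒∣leftFactorial d zero    d∣ rewrite ℕP.+-identityʳ d = d∣
∣leftFactorial[+]⇒∣leftFactorial d (suc t) d∣ rewrite ℕP.+-suc d t | leftFactorial-suc (d + t) =
  ∣leftFactorial[+]⇒∣leftFactorial d t
    (∣m+n∣m⇒∣n (subst (d ∣_) (ℕP.+-comm (leftFactorial (d + t)) ((d + t) !)) d∣) (n∣[n+t]! d t))

∣leftFactorial-reduce : ∀ {d n} .{{_ : ℕ.NonZero d}} → d ≤ n → d ∣ leftFactorial n → d ∣ leftFactorial d
∣leftFactorial-reduce {d} d≤n with ℕP.m≤n⇒∃[o]m+o≡n d≤n
... | t , refl = ∣leftFactorial[+]⇒∣leftFactorial d t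

4∤leftFactorial[4+] : ∀ t → ¬ 4 ∣ leftFactorial (4 + t)
4∤leftFactorial[4+] zero    = toWitnessFalse {a? = 4 ∣? 10} _
4∤leftFactorial[4+] (suc t) 4∣ = 4∤leftFactorial[4+] t
  (∣m+n∣m⇒∣n (subst (4 ∣_) (trans (leftFactorial-suc (4 + t)) (ℕP.+-comm (leftFactorial (4 + t)) _)) 4∣)
    (n∣[n+t]! 4 t))

even⊎odd : ∀ n → (∃[ j ] n ≡ 2 * j) ⊎ (∃[ j ] n ≡ suc (2 * j))
even⊎odd zero = inj₁ (0 , refl)
even⊎odd (suc n) with even⊎odd n
... | inj₁ (j , refl) = inj₂ (j , refl)
... | inj₂ (j , refl) = inj₁ (suc j , cong suc (sym (ℕP.+-suc j (j + 0))))

2∤odd : ∀ j → ¬ 2 ∣ suc (2 * j)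
2∤odd j (divides q eq) = ℕP.even≢odd q j (sym (trans eq (ℕP.*-comm q 2)))

∃prime∣ : ∀ n → 1 < n → ∃[ p ] Prime p × p ∣ n
∃prime∣ n@(suc _) 1<n with factorise n
... | record { factors = [] ; isFactorisation = n≡1 } = contradiction n≡1 (ℕP.>⇒≢ 1<n)
... | record { factors = p ∷ ps ; isFactorisation = n≡p*ps ; factorsPrime = p-prime ∷ _ } =
  p , p-prime , divides (product ps) (trans n≡p*ps (ℕP.*-comm p (product ps)))

prime>1 : ∀ {p} → Prime p → 1 < p
prime>1 {p} p-prime = ℕ.nonTrivial⇒n>1 p {{prime⇒nonTrivial p-prime}}

∃oddPrime∣odd : ∀ j → 0 < j → ∃[ p ] Prime p × 2 < p × p ∣ suc (2 * j)
∃oddPrime∣odd j 0<j with ∃prime∣ (suc (2 * j)) (s≤s (ℕP.≤-trans 0<j (ℕP.m≤m+n j (j + 0))))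
... | p , p-prime , p∣n = p , p-prime , 2<p , p∣n
  where
  2<p : 2 < p
  2<p = ℕP.≤∧≢⇒< (prime>1 p-prime) λ 2≡p → 2∤odd j (subst (_∣ suc (2 * j)) (sym 2≡p) p∣n)

∃oddPrime∣ : ∀ n → 2 < n → ¬ 4 ∣ n → ∃[ p ] Prime p × 2 < p × p ∣ n
∃oddPrime∣ n 2<n 4∤n with even⊎odd n
... | inj₂ (zero , refl) = contradiction 2<n λ { (s≤s ()) }
... | inj₂ (suc j , refl) = ∃oddPrime∣odd (suc j) (s≤s z≤n)
... | inj₁ (m , refl) with even⊎odd m
...   | inj₁ (i , refl) = contradiction (divides i (trans (sym (ℕP.*-assoc 2 2 i)) (ℕP.*-comm 4 i))) 4∤n
...   | inj₂ (zero , refl) = contradiction 2<n λ { (s≤s (s≤s ())) }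
...   | inj₂ (suc i , refl) with ∃oddPrime∣odd (suc i) (s≤s z≤n)
...     | p , p-prime , 2<p , p∣m = p , p-prime , 2<p , ∣-trans p∣m (n∣m*n 2)

prime>2⇒odd : ∀ {p} → Prime p → 2 < p → ∃[ h ] p ≡ suc (2 * h)
prime>2⇒odd {p} p-prime 2<p with even⊎odd p
... | inj₁ (j , refl) = contradiction (hasNonTrivialDivisor 2<p (divides j (ℕP.*-comm 2 j))) (Prime.notComposite p-prime)
... | inj₂ odd = odd

∣leftFactorial⇒4∤ : ∀ {n} .{{_ : ℕ.NonZero n}} → n ∣ leftFactorial n → ¬ 4 ∣ n
∣leftFactorial⇒4∤ n∣!n 4∣n with ℕP.m≤n⇒∃[o]m+o≡n (∣⇒≤ 4∣n)
... | t , refl = 4∤leftFactorial[4+] t (∣-trans 4∣n n∣!n)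

∣leftFactorial⇒∃oddPrime : ∀ n → 2 < n → n ∣ leftFactorial n → ∃[ p ] Prime p × 2 < p × p ∣ leftFactorial p
∣leftFactorial⇒∃oddPrime n@(suc _) 2<n n∣!n with ∃oddPrime∣ n 2<n (∣leftFactorial⇒4∤ n∣!n)
... | p , p-prime , 2<p , p∣n =
  p , p-prime , 2<p , ∣leftFactorial-reduce {{prime⇒nonZero p-prime}} (∣⇒≤ p∣n) (∣-trans p∣n n∣!n)

-- Σ_{j ≤ m} (-1)^j x(x-1)⋯(x-j+1)
alternatingFallingSum : ℕ → ℤ → ℤ
alternatingFallingSum zero    x = 1ℤ
alternatingFallingSum (suc m) x = 1ℤ ℤ.- x ℤ.* alternatingFallingSum m (x ℤ.- 1ℤ)

alternatingFallingSum-cong : ∀ {k} m {x y} → k ℤ∣.∣ x ℤ.- y →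
                             k ℤ∣.∣ alternatingFallingSum m x ℤ.- alternatingFallingSum m y
alternatingFallingSum-cong zero    k∣x-y = ℤ∣.divides 0ℤ refl
alternatingFallingSum-cong {k} (suc m) {x} {y} k∣x-y =
  subst (k ℤ∣.∣_) (solve 4 (λ x y qx qy → :- (x :* (qx :- qy) :+ (x :- y) :* qy) :=
                                          (con 1ℤ :- x :* qx) :- (con 1ℤ :- y :* qy)) refl x y qx qy)
    (ℤ∣.∣m⇒∣-m (ℤ∣.∣m∣n⇒∣m+n (ℤ∣.∣n⇒∣m*n x k∣qx-qy) (ℤ∣.∣m⇒∣m*n qy k∣x-y)))
  where
  open ℤ-Solver
  qx = alternatingFallingSum m (x ℤ.- 1ℤ)
  qy = alternatingFallingSum m (y ℤ.- 1ℤ)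
  k∣qx-qy : k ℤ∣.∣ qx ℤ.- qy
  k∣qx-qy = alternatingFallingSum-cong m
    (subst (k ℤ∣.∣_) (solve 2 (λ x y → x :- y := (x :- con 1ℤ) :- (y :- con 1ℤ)) refl x y) k∣x-y)

-- At x = -(c+1) the sum is Σ_{j ≤ m} (c+j)!/c!, which telescopes into left factorials.
alternatingFallingSum-neg : ∀ m c → + (c !) ℤ.* alternatingFallingSum m (ℤ.- + suc c) ℤ.+ + leftFactorial c
                                   ≡ + leftFactorial (suc (c + m))
alternatingFallingSum-neg zero c = begin
  + (c !) ℤ.* 1ℤ ℤ.+ + leftFactorial c  ≡⟨ cong (ℤ._+ + leftFactorial c) (ℤP.*-identityʳ (+ (c !))) ⟩
  + (c !) ℤ.+ + leftFactorial c         ≡⟨ ℤP.+-comm (+ (c !)) (+ leftFactorial c) ⟩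
  + (leftFactorial c + c !)           ≡⟨ cong +_ (leftFactorial-suc c) ⟨
  + leftFactorial (suc c)               ≡⟨ cong (λ n → + leftFactorial (suc n)) (ℕP.+-identityʳ c) ⟨
  + leftFactorial (suc (c + 0))       ∎
  where open ≡-Reasoning
alternatingFallingSum-neg (suc m) c = begin
  C ℤ.* (1ℤ ℤ.- (ℤ.- S) ℤ.* alternatingFallingSum m (ℤ.- S ℤ.- 1ℤ)) ℤ.+ L
    ≡⟨ cong (λ x → C ℤ.* (1ℤ ℤ.- (ℤ.- S) ℤ.* alternatingFallingSum m x) ℤ.+ L)
            (solve 1 (λ S → :- S :- con 1ℤ := :- (con 1ℤ :+ S)) refl S) ⟩
  C ℤ.* (1ℤ ℤ.- (ℤ.- S) ℤ.* q) ℤ.+ L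
    ≡⟨ solve 4 (λ C S q L → C :* (con 1ℤ :- (:- S) :* q) :+ L := (S :* C) :* q :+ (L :+ C)) refl C S q L ⟩
  (S ℤ.* C) ℤ.* q ℤ.+ (L ℤ.+ C)
    ≡⟨ cong₂ (λ a b → a ℤ.* q ℤ.+ b) (ℤP.pos-* (suc c) (c !)) (cong +_ (leftFactorial-suc c)) ⟨
  + (suc c !) ℤ.* q ℤ.+ + leftFactorial (suc c)
    ≡⟨ alternatingFallingSum-neg m (suc c) ⟩
  + leftFactorial (suc (suc c + m))
    ≡⟨ cong (λ n → + leftFactorial (suc n)) (ℕP.+-suc c m) ⟨
  + leftFactorial (suc (c + suc m)) ∎
  where
  open ≡-Reasoning
  open ℤ-Solver
  C = + (c !)
  S = + suc c
  L = + leftFactorial c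
  q = alternatingFallingSum m (ℤ.- + suc (suc c))

alternatingFallingSum-[-1] : ∀ m → alternatingFallingSum m -1ℤ ≡ + leftFactorial (suc m)
alternatingFallingSum-[-1] m =
  trans (sym (trans (ℤP.+-identityʳ _) (ℤP.*-identityˡ _))) (alternatingFallingSum-neg m 0)

derangements : ℕ → ℕ
derangements zero          = 1
derangements (suc zero)    = 0
derangements (suc (suc n)) = suc n * (derangements (suc n) + derangements n)

derangements-suc : ∀ n → + derangements (suc n) ≡ + suc n ℤ.* + derangements n ℤ.+ -1ℤ ^ suc n
derangements-suc zero    = refl
derangements-suc (suc n) = begin
  + (suc n * (derangements (suc n) + derangements n))
    ≡⟨ trans (ℤP.pos-* (suc n) _) (cong (N ℤ.*_) (ℤP.pos-+ (derangements (suc n)) (derangements n))) ⟩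
  N ℤ.* (+ derangements (suc n) ℤ.+ D)
    ≡⟨ cong (λ d → N ℤ.* (d ℤ.+ D)) (derangements-suc n) ⟩
  N ℤ.* ((N ℤ.* D ℤ.+ s) ℤ.+ D)
    ≡⟨ solve 3 (λ N D s → N :* ((N :* D :+ s) :+ D) := (con 1ℤ :+ N) :* (N :* D :+ s) :+ (:- con 1ℤ) :* s) refl N D s ⟩
  (1ℤ ℤ.+ N) ℤ.* (N ℤ.* D ℤ.+ s) ℤ.+ -1ℤ ℤ.* s
    ≡⟨ cong (λ d → (1ℤ ℤ.+ N) ℤ.* d ℤ.+ -1ℤ ℤ.* s) (derangements-suc n) ⟨
  + suc (suc n) ℤ.* + derangements (suc n) ℤ.+ -1ℤ ^ suc (suc n) ∎
  where
  open ≡-Reasoning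
  open ℤ-Solver
  N = + suc n
  D = + derangements n
  s = -1ℤ ^ suc n

derangements-alternatingFallingSum : ∀ n → + derangements n ≡ -1ℤ ^ n ℤ.* alternatingFallingSum n (+ n)
derangements-alternatingFallingSum zero    = refl
derangements-alternatingFallingSum (suc n) = begin
  + derangements (suc n)                ≡⟨ derangements-suc n ⟩
  N ℤ.* + derangements n ℤ.+ -1ℤ ℤ.* s  ≡⟨ cong (λ d → N ℤ.* d ℤ.+ -1ℤ ℤ.* s) (derangements-alternatingFallingSum n) ⟩
  N ℤ.* (s ℤ.* q) ℤ.+ -1ℤ ℤ.* s         ≡⟨ solve 3 (λ N s q → N :* (s :* q) :+ (:- con 1ℤ) :* s :=
                                                          ((:- con 1ℤ) :* s) :* (con 1ℤ :- N :* q)) refl N s q ⟩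
  (-1ℤ ℤ.* s) ℤ.* (1ℤ ℤ.- N ℤ.* q)      ∎
  where
  open ≡-Reasoning
  open ℤ-Solver
  N = + suc n
  s = -1ℤ ^ n
  q = alternatingFallingSum n (+ n)

derangements≡±leftFactorial : ∀ n → + suc n ℤ∣.∣ + derangements n ℤ.- -1ℤ ^ n ℤ.* + leftFactorial (suc n)
derangements≡±leftFactorial n =
  subst₂ (λ d l → + suc n ℤ∣.∣ d ℤ.- s ℤ.* l)
    (sym (derangements-alternatingFallingSum n)) (alternatingFallingSum-[-1] n)
    (subst (+ suc n ℤ∣.∣_) (solve 3 (λ s a b → s :* (a :- b) := s :* a :- s :* b) refl s (Q (+ n)) (Q -1ℤ))
      (ℤ∣.∣n⇒∣m*n s (alternatingFallingSum-cong n n+1∣n-[-1])))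
  where
  open ℤ-Solver
  s = -1ℤ ^ n
  Q = alternatingFallingSum n
  n+1∣n-[-1] : + suc n ℤ∣.∣ + n ℤ.- -1ℤ
  n+1∣n-[-1] = ℤ∣.divides 1ℤ (trans (cong +_ (ℕP.+-comm n 1)) (sym (ℤP.*-identityˡ (+ suc n))))

∣-difference⇒∣⇔∣ : ∀ {d a b} → + d ℤ∣.∣ + a ℤ.- + b → d ∣ a ⇔ d ∣ b
∣-difference⇒∣⇔∣ {d} {a} {b} d∣a-b = mk⇔
  (λ d∣a → ℤ∣.∣⇒∣ᵤ (subst (+ d ℤ∣.∣_) (solve 2 (λ a b → a :- (a :- b) := b) refl (+ a) (+ b))
                     (ℤ∣.∣m∣n⇒∣m-n (ℤ∣.∣ᵤ⇒∣ {i = + a} d∣a) d∣a-b)))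
  (λ d∣b → ℤ∣.∣⇒∣ᵤ (subst (+ d ℤ∣.∣_) (solve 2 (λ a b → (a :- b) :+ b := a) refl (+ a) (+ b))
                     (ℤ∣.∣m∣n⇒∣m+n d∣a-b (ℤ∣.∣ᵤ⇒∣ {i = + b} d∣b))))
  where open ℤ-Solver

∣derangements⇔∣leftFactorial : ∀ h → let p = suc (2 * h) in p ∣ derangements (2 * h) ⇔ p ∣ leftFactorial p
∣derangements⇔∣leftFactorial h = ∣-difference⇒∣⇔∣
  (subst (λ l → + suc n ℤ∣.∣ + derangements n ℤ.- l) -1^n*L≡L (derangements≡±leftFactorial n))
  where
  n = 2 * h
  -1^n*L≡L : -1ℤ ^ n ℤ.* + leftFactorial (suc n) ≡ + leftFactorial (suc n)
  -1^n*L≡L = trans (cong (ℤ._* + leftFactorial (suc n)) (trans (sym (ℤP.^-*-assoc -1ℤ 2 h)) (ℤP.^-zeroˡ h)))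
                   (ℤP.*-identityˡ (+ leftFactorial (suc n)))

open ℚ-Solver

∑ : ℕ → (ℕ → ℚ) → ℚ
∑ zero    f = 0ℚ
∑ (suc n) f = ∑ n f ℚ.+ f n

-- Opaque, so that unification never starts evaluating the gcd normalisation inside `+ n / 1`.
opaque
  ι : ℕ → ℚ
  ι n = + n / 1

  /1≡ι : ∀ n → + n / 1 ≡ ι n
  /1≡ι n = refl

  ι-0 : ι 0 ≡ 0ℚ
  ι-0 = refl

  ι-1 : ι 1 ≡ 1ℚ
  ι-1 = refl

  private
    ι≡mkℚ : ∀ n → ι n ≡ mkℚ (+ n) 0 (coprime-sym (1-coprimeTo n))
    ι≡mkℚ n = ℚP.normalize-coprime (coprime-sym (1-coprimeTo n))

  ι-+ : ∀ m n → ι (m + n) ≡ ι m ℚ.+ ι n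
  ι-+ m n rewrite ι≡mkℚ m | ι≡mkℚ n =
    ℚP./-cong (trans (ℤP.pos-+ m n) (sym (cong₂ ℤ._+_ (ℤP.*-identityʳ (+ m)) (ℤP.*-identityʳ (+ n))))) refl

  ι-* : ∀ m n → ι (m * n) ≡ ι m ℚ.* ι n
  ι-* m n rewrite ι≡mkℚ m | ι≡mkℚ n = ℚP./-cong (ℤP.pos-* m n) refl

  ι-mono-≤ : ∀ {m n} → m ≤ n → ι m ℚ.≤ ι n
  ι-mono-≤ {m} {n} m≤n rewrite ι≡mkℚ m | ι≡mkℚ n =
    ℚ.*≤* (subst₂ ℤ._≤_ (sym (ℤP.*-identityʳ (+ m))) (sym (ℤP.*-identityʳ (+ n))) (ℤ.+≤+ m≤n))

  ι-mono-< : ∀ {m n} → m < n → ι m ℚ.< ι n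
  ι-mono-< {m} {n} m<n rewrite ι≡mkℚ m | ι≡mkℚ n =
    ℚ.*<* (subst₂ ℤ._<_ (sym (ℤP.*-identityʳ (+ m))) (sym (ℤP.*-identityʳ (+ n))) (ℤ.+<+ m<n))

  ι-cancel-< : ∀ {m n} → ι m ℚ.< ι n → m < n
  ι-cancel-< {m} {n} ιm<ιn rewrite ι≡mkℚ m | ι≡mkℚ n with ιm<ιn
  ... | ℚ.*<* m<n = ℤP.drop‿+<+ (subst₂ ℤ._<_ (ℤP.*-identityʳ (+ m)) (ℤP.*-identityʳ (+ n)) m<n)

  inv! : ℕ → ℚ
  inv! n = _/_ (+ 1) (n !) {{n !≢0}}

  inv!-0 : inv! 0 ≡ 1ℚ
  inv!-0 = refl

  inv!-pos : ∀ n → 0ℚ ℚ.< inv! n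
  inv!-pos n = ℚP.positive⁻¹ (inv! n) {{ℚP.normalize-pos 1 (n !) {{n !≢0}}}}

  inv!-*-! : ∀ n → inv! n ℚ.* ι (n !) ≡ 1ℚ
  inv!-*-! n = inverse (n !) {{n !≢0}}
    where
    inverse : ∀ m .{{_ : ℕ.NonZero m}} → (+ 1 / m) ℚ.* ι m ≡ 1ℚ
    inverse m@(suc m-1) = ℚP.toℚᵘ-injective (ℚᵘP.≃-trans (ℚP.toℚᵘ-homo-* (+ 1 / m) (ι m))
      (ℚᵘP.≃-trans (ℚᵘP.*-cong (ℚP.toℚᵘ-fromℚᵘ (mkℚᵘ (+ 1) m-1)) (ℚP.toℚᵘ-fromℚᵘ (mkℚᵘ (+ m) 0)))
        (ℚᵘ.*≡* (cong (λ k → + suc k) (trans (ℕP.*-identityʳ (m-1 + 0))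
                   (trans (ℕP.+-identityʳ m-1) (sym (trans (ℕP.+-identityʳ (m-1 * 1)) (ℕP.*-identityʳ m-1)))))))))

  ePartial≡∑inv! : ∀ n → ePartial n ≡ ∑ n inv!
  ePartial≡∑inv! zero    = refl
  ePartial≡∑inv! (suc n) = cong (ℚ._+ inv! n) (ePartial≡∑inv! n)

inv!-suc : ∀ n → inv! n ≡ ι (suc n) ℚ.* inv! (suc n)
inv!-suc n = begin
  inv! n                                                ≡⟨ ℚP.*-identityʳ (inv! n) ⟨
  inv! n ℚ.* 1ℚ                                         ≡⟨ cong (inv! n ℚ.*_) (inv!-*-! (suc n)) ⟨
  inv! n ℚ.* (inv! (suc n) ℚ.* ι (suc n * n !))       ≡⟨ cong (λ x → inv! n ℚ.* (inv! (suc n) ℚ.* x)) (ι-* (suc n) (n !)) ⟩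
  inv! n ℚ.* (inv! (suc n) ℚ.* (ι (suc n) ℚ.* ι (n !))) ≡⟨ solve 4 (λ a b s f → a :* (b :* (s :* f)) := (s :* b) :* (a :* f))
                                                                   refl (inv! n) (inv! (suc n)) (ι (suc n)) (ι (n !)) ⟩
  (ι (suc n) ℚ.* inv! (suc n)) ℚ.* (inv! n ℚ.* ι (n !)) ≡⟨ cong (ι (suc n) ℚ.* inv! (suc n) ℚ.*_) (inv!-*-! n) ⟩
  (ι (suc n) ℚ.* inv! (suc n)) ℚ.* 1ℚ                   ≡⟨ ℚP.*-identityʳ _ ⟩
  ι (suc n) ℚ.* inv! (suc n)                            ∎
  where open ≡-Reasoning

inv!-nonNeg : ∀ n → 0ℚ ℚ.≤ inv! n
inv!-nonNeg n = ℚP.<⇒≤ (inv!-pos n)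

inv!-antitone : ∀ n → inv! (suc n) ℚ.≤ inv! n
inv!-antitone n = begin
  inv! (suc n)               ≡⟨ ℚP.*-identityˡ (inv! (suc n)) ⟨
  1ℚ ℚ.* inv! (suc n)        ≤⟨ ℚP.*-monoʳ-≤-nonNeg (inv! (suc n)) {{ℚ.nonNegative (inv!-nonNeg (suc n))}}
                                  (subst (ℚ._≤ ι (suc n)) ι-1 (ι-mono-≤ (s≤s z≤n))) ⟩
  ι (suc n) ℚ.* inv! (suc n) ≡⟨ inv!-suc n ⟨
  inv! n                     ∎
  where open ℚP.≤-Reasoning

sign : ℕ → ℚ
sign zero    = 1ℚ
sign (suc n) = ℚ.- sign n

sign-+ : ∀ m n → sign (m + n) ≡ sign m ℚ.* sign n
sign-+ zero    n = sym (ℚP.*-identityˡ (sign n))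
sign-+ (suc m) n = trans (cong ℚ.-_ (sign-+ m n)) (ℚP.neg-distribˡ-* (sign m) (sign n))

sign-*-sign : ∀ n → sign n ℚ.* sign n ≡ 1ℚ
sign-*-sign zero    = refl
sign-*-sign (suc n) = trans (solve 1 (λ s → (:- s) :* (:- s) := s :* s) refl (sign n)) (sign-*-sign n)

sign-even : ∀ h → sign (2 * h) ≡ 1ℚ
sign-even h = trans (sign-+ h (h + 0)) (trans (cong (λ k → sign h ℚ.* sign k) (ℕP.+-identityʳ h)) (sign-*-sign h))

sign-∸ : ∀ {m n} → n ≤ m → sign (m ∸ n) ≡ sign m ℚ.* sign n
sign-∸ {m} {n} n≤m = begin
  sign (m ∸ n)                          ≡⟨ ℚP.*-identityʳ _ ⟨
  sign (m ∸ n) ℚ.* 1ℚ                   ≡⟨ cong (sign (m ∸ n) ℚ.*_) (sign-*-sign n) ⟨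
  sign (m ∸ n) ℚ.* (sign n ℚ.* sign n)  ≡⟨ ℚP.*-assoc (sign (m ∸ n)) (sign n) (sign n) ⟨
  (sign (m ∸ n) ℚ.* sign n) ℚ.* sign n  ≡⟨ cong (ℚ._* sign n) (sign-+ (m ∸ n) n) ⟨
  sign (m ∸ n + n) ℚ.* sign n         ≡⟨ cong (λ k → sign k ℚ.* sign n) (ℕP.m∸n+n≡m n≤m) ⟩
  sign m ℚ.* sign n                     ∎
  where open ≡-Reasoning

∑-cong : ∀ n {f g : ℕ → ℚ} → (∀ {j} → j < n → f j ≡ g j) → ∑ n f ≡ ∑ n g
∑-cong zero    f≡g = refl
∑-cong (suc n) f≡g = cong₂ ℚ._+_ (∑-cong n (λ j<n → f≡g (ℕP.m<n⇒m<1+n j<n))) (f≡g ℕP.≤-refl)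

∑-+ : ∀ n (f g : ℕ → ℚ) → ∑ n (λ j → f j ℚ.+ g j) ≡ ∑ n f ℚ.+ ∑ n g
∑-+ zero    f g = refl
∑-+ (suc n) f g = trans (cong (ℚ._+ (f n ℚ.+ g n)) (∑-+ n f g))
  (solve 4 (λ a b c d → (a :+ b) :+ (c :+ d) := (a :+ c) :+ (b :+ d)) refl (∑ n f) (∑ n g) (f n) (g n))

∑-*ˡ : ∀ n c (f : ℕ → ℚ) → ∑ n (λ j → c ℚ.* f j) ≡ c ℚ.* ∑ n f
∑-*ˡ zero    c f = sym (ℚP.*-zeroʳ c)
∑-*ˡ (suc n) c f = trans (cong (ℚ._+ c ℚ.* f n) (∑-*ˡ n c f)) (sym (ℚP.*-distribˡ-+ c (∑ n f) (f n)))

∑-+-length : ∀ m n (f : ℕ → ℚ) → ∑ (m + n) f ≡ ∑ m f ℚ.+ ∑ n (λ i → f (m + i))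
∑-+-length m zero    f = trans (cong (λ k → ∑ k f) (ℕP.+-identityʳ m)) (sym (ℚP.+-identityʳ (∑ m f)))
∑-+-length m (suc n) f rewrite ℕP.+-suc m n | ∑-+-length m n f =
  ℚP.+-assoc (∑ m f) (∑ n (λ i → f (m + i))) (f (m + n))

∑-mono-≤ : ∀ n {f g : ℕ → ℚ} → (∀ {j} → j < n → f j ℚ.≤ g j) → ∑ n f ℚ.≤ ∑ n g
∑-mono-≤ zero    f≤g = ℚP.≤-refl
∑-mono-≤ (suc n) f≤g = ℚP.+-mono-≤ (∑-mono-≤ n (λ j<n → f≤g (ℕP.m<n⇒m<1+n j<n))) (f≤g ℕP.≤-refl)

∑-nonNeg : ∀ n {f : ℕ → ℚ} → (∀ j → 0ℚ ℚ.≤ f j) → 0ℚ ℚ.≤ ∑ n f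
∑-nonNeg zero    f≥0 = ℚP.≤-refl
∑-nonNeg (suc n) f≥0 = ℚP.+-mono-≤ (∑-nonNeg n f≥0) (f≥0 n)

p≤p+q : ∀ p {q} → 0ℚ ℚ.≤ q → p ℚ.≤ p ℚ.+ q
p≤p+q p 0≤q = subst (ℚ._≤ p ℚ.+ _) (ℚP.+-identityʳ p) (ℚP.+-monoʳ-≤ p 0≤q)

p-q≤p : ∀ p {q} → 0ℚ ℚ.≤ q → p ℚ.- q ℚ.≤ p
p-q≤p p 0≤q = subst (p ℚ.- _ ℚ.≤_) (ℚP.+-identityʳ p) (ℚP.+-monoʳ-≤ p (ℚP.neg-antimono-≤ 0≤q))

∑-mono-length : ∀ {f : ℕ → ℚ} → (∀ j → 0ℚ ℚ.≤ f j) → ∀ {m n} → m ≤ n → ∑ m f ℚ.≤ ∑ n f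
∑-mono-length {f} f≥0 {m} m≤n with ℕP.m≤n⇒∃[o]m+o≡n m≤n
... | o , refl = subst (∑ m f ℚ.≤_) (sym (∑-+-length m o f)) (p≤p+q (∑ m f) (∑-nonNeg o (λ i → f≥0 (m + i))))

stepwise-monotone : ∀ {A : Set} {_≼_ : A → A → Set} → Reflexive _≼_ → Transitive _≼_ →
                    (f : ℕ → A) → (∀ n → f n ≼ f (suc n)) → ∀ {m n} → m ≤ n → f m ≼ f n
stepwise-monotone {_≼_ = _≼_} ≼-refl ≼-trans f step m≤n = go (ℕP.≤⇒≤′ m≤n)
  where
  go : ∀ {m n} → m ℕ.≤′ n → f m ≼ f n
  go ℕ.≤′-refl        = ≼-refl
  go (ℕ.≤′-step m≤′n) = ≼-trans (go m≤′n) (step _)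

2*m≤1+2*n⇒m≤n : ∀ {m n} → 2 * m ≤ suc (2 * n) → m ≤ n
2*m≤1+2*n⇒m≤n {m} {n} 2m≤1+2n = ℕP.*-cancelˡ-≤ 2 (ℕ.s≤s⁻¹ (ℕP.≤∧≢⇒< 2m≤1+2n (ℕP.even≢odd m n)))

module AlternatingSeries (t : ℕ → ℚ) (t-nonNeg : ∀ n → 0ℚ ℚ.≤ t n) (t-antitone : ∀ n → t (suc n) ℚ.≤ t n) where

  partialSum : ℕ → ℚ
  partialSum n = ∑ n (λ i → sign i ℚ.* t i)

  partialSum-suc-suc : ∀ n → partialSum (suc (suc n)) ≡ partialSum n ℚ.+ sign n ℚ.* (t n ℚ.- t (suc n))
  partialSum-suc-suc n = solve 4 (λ s σ a b → (s :+ σ :* a) :+ (:- σ) :* b := s :+ σ :* (a :- b))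
                                 refl (partialSum n) (sign n) (t n) (t (suc n))

  private
    S = partialSum
    S-suc-suc = partialSum-suc-suc

    0≤t-t : ∀ n → 0ℚ ℚ.≤ t n ℚ.- t (suc n)
    0≤t-t n = subst (ℚ._≤ t n ℚ.- t (suc n)) (ℚP.+-inverseʳ (t (suc n))) (ℚP.+-monoˡ-≤ (ℚ.- t (suc n)) (t-antitone n))

    even≤odd : ∀ j → S (2 * j) ℚ.≤ S (suc (2 * j))
    even≤odd j = begin
      S n                      ≤⟨ p≤p+q (S n) (t-nonNeg n) ⟩
      S n ℚ.+ t n              ≡⟨ cong (S n ℚ.+_) (ℚP.*-identityˡ (t n)) ⟨
      S n ℚ.+ 1ℚ ℚ.* t n       ≡⟨ cong (λ σ → S n ℚ.+ σ ℚ.* t n) (sign-even j) ⟨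
      S (suc n)                ∎
      where
      open ℚP.≤-Reasoning
      n = 2 * j

    evens-increasing : ∀ j → S (2 * j) ℚ.≤ S (2 * suc j)
    evens-increasing j = begin
      S n                                ≤⟨ p≤p+q (S n) (0≤t-t n) ⟩
      S n ℚ.+ d                          ≡⟨ cong (S n ℚ.+_) (ℚP.*-identityˡ d) ⟨
      S n ℚ.+ 1ℚ ℚ.* d                   ≡⟨ cong (λ σ → S n ℚ.+ σ ℚ.* d) (sign-even j) ⟨
      S n ℚ.+ sign n ℚ.* d               ≡⟨ S-suc-suc n ⟨
      S (suc (suc n))                    ≡⟨ cong S (ℕP.*-suc 2 j) ⟨
      S (2 * suc j)                    ∎
      where
      open ℚP.≤-Reasoning
      n = 2 * j
      d = t n ℚ.- t (suc n)

    odds-decreasing : ∀ j → S (suc (2 * suc j)) ℚ.≤ S (suc (2 * j))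
    odds-decreasing j = begin
      S (suc (2 * suc j))              ≡⟨ cong (λ k → S (suc k)) (ℕP.*-suc 2 j) ⟩
      S (suc (suc n))                    ≡⟨ S-suc-suc n ⟩
      S n ℚ.+ ℚ.- sign (2 * j) ℚ.* d   ≡⟨ cong (λ σ → S n ℚ.+ ℚ.- σ ℚ.* d) (sign-even j) ⟩
      S n ℚ.+ ℚ.- 1ℚ ℚ.* d               ≡⟨ solve 2 (λ s d → s :+ (:- con 1ℚ) :* d := s :- d) refl (S n) d ⟩
      S n ℚ.- d                          ≤⟨ p-q≤p (S n) (0≤t-t n) ⟩
      S n                                ∎
      where
      open ℚP.≤-Reasoning
      n = suc (2 * j)
      d = t n ℚ.- t (suc n)

    evens : ∀ {h j} → h ≤ j → S (2 * h) ℚ.≤ S (2 * j)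
    evens = stepwise-monotone {_≼_ = ℚ._≤_} ℚP.≤-refl ℚP.≤-trans (λ j → S (2 * j)) evens-increasing

    odds : ∀ {h j} → h ≤ j → S (suc (2 * j)) ℚ.≤ S (suc (2 * h))
    odds = stepwise-monotone {_≼_ = flip ℚ._≤_} ℚP.≤-refl (flip ℚP.≤-trans) (λ j → S (suc (2 * j))) odds-decreasing

  even≤partialSum : ∀ h {k} → 2 * h ≤ k → partialSum (2 * h) ℚ.≤ partialSum k
  even≤partialSum h {k} 2h≤k with even⊎odd k
  ... | inj₁ (j , refl) = evens {h} {j} (ℕP.*-cancelˡ-≤ 2 2h≤k)
  ... | inj₂ (j , refl) = ℚP.≤-trans (evens {h} {j} (2*m≤1+2*n⇒m≤n 2h≤k)) (even≤odd j)

  partialSum≤odd : ∀ h {k} → 2 * h ≤ k → partialSum k ℚ.≤ partialSum (suc (2 * h))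
  partialSum≤odd h {k} 2h≤k with even⊎odd k
  ... | inj₁ (j , refl) = ℚP.≤-trans (even≤odd j) (odds {h} {j} (ℕP.*-cancelˡ-≤ 2 2h≤k))
  ... | inj₂ (j , refl) = odds {h} {j} (2*m≤1+2*n⇒m≤n 2h≤k)


open AlternatingSeries inv! inv!-nonNeg inv!-antitone
  renaming ( partialSum to e⁻¹Partial; partialSum-suc-suc to e⁻¹Partial-suc-suc
           ; even≤partialSum to e⁻¹Partial-even≤; partialSum≤odd to e⁻¹Partial≤odd)

e⁻¹Partial-nonNeg : ∀ n → 0ℚ ℚ.≤ e⁻¹Partial n
e⁻¹Partial-nonNeg n = e⁻¹Partial-even≤ 0 {n} z≤n

e⁻¹Partial-1 : e⁻¹Partial 1 ≡ 1ℚ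
e⁻¹Partial-1 = trans (ℚP.+-identityˡ _) (trans (ℚP.*-identityˡ (inv! 0)) inv!-0)

e⁻¹Partial≤1 : ∀ n → e⁻¹Partial n ℚ.≤ 1ℚ
e⁻¹Partial≤1 n = subst (e⁻¹Partial n ℚ.≤_) e⁻¹Partial-1 (e⁻¹Partial≤odd 0 {n} z≤n)

-- (1/s!) Σ_{j ≤ t} (-1)^j C(s,j)
binomialAlternatingSum : ℕ → ℕ → ℚ
binomialAlternatingSum s t = ∑ (suc t) (λ j → sign j ℚ.* (inv! j ℚ.* inv! (s ∸ j)))

binomialAlternatingSum-partial : ∀ t u → ι (suc (t + u)) ℚ.* binomialAlternatingSum (suc (t + u)) t
                                         ≡ sign t ℚ.* (inv! t ℚ.* inv! u)
binomialAlternatingSum-partial zero u = begin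
  ι (suc u) ℚ.* (0ℚ ℚ.+ 1ℚ ℚ.* (inv! 0 ℚ.* inv! (suc u)))
    ≡⟨ solve 3 (λ a x y → a :* (con 0ℚ :+ con 1ℚ :* (x :* y)) := con 1ℚ :* (x :* (a :* y)))
               refl (ι (suc u)) (inv! 0) (inv! (suc u)) ⟩
  1ℚ ℚ.* (inv! 0 ℚ.* (ι (suc u) ℚ.* inv! (suc u)))
    ≡⟨ cong (λ z → 1ℚ ℚ.* (inv! 0 ℚ.* z)) (inv!-suc u) ⟨
  1ℚ ℚ.* (inv! 0 ℚ.* inv! u) ∎
  where open ≡-Reasoning
binomialAlternatingSum-partial (suc t) u = begin
  ι s ℚ.* (P ℚ.+ (ℚ.- sign t) ℚ.* (x ℚ.* inv! (s ∸ suc t)))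
    ≡⟨ cong (λ k → ι s ℚ.* (P ℚ.+ (ℚ.- sign t) ℚ.* (x ℚ.* inv! k))) s∸[1+t]≡1+u ⟩
  ι s ℚ.* (P ℚ.+ (ℚ.- sign t) ℚ.* (x ℚ.* y))
    ≡⟨ cong (λ z → z ℚ.* (P ℚ.+ (ℚ.- sign t) ℚ.* (x ℚ.* y))) ιs≡A+B ⟩
  (A ℚ.+ B) ℚ.* (P ℚ.+ (ℚ.- sign t) ℚ.* (x ℚ.* y))
    ≡⟨ solve 6 (λ A B P σ x y → (A :+ B) :* (P :+ (:- σ) :* (x :* y)) :=
                                (A :+ B) :* P :+ (:- σ) :* ((A :+ B) :* (x :* y))) refl A B P (sign t) x y ⟩
  (A ℚ.+ B) ℚ.* P ℚ.+ (ℚ.- sign t) ℚ.* ((A ℚ.+ B) ℚ.* (x ℚ.* y))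
    ≡⟨ cong (λ z → z ℚ.+ (ℚ.- sign t) ℚ.* ((A ℚ.+ B) ℚ.* (x ℚ.* y))) (trans (cong (ℚ._* P) (sym ιs≡A+B)) IH) ⟩
  sign t ℚ.* (inv! t ℚ.* y) ℚ.+ (ℚ.- sign t) ℚ.* ((A ℚ.+ B) ℚ.* (x ℚ.* y))
    ≡⟨ cong (λ z → sign t ℚ.* (z ℚ.* y) ℚ.+ (ℚ.- sign t) ℚ.* ((A ℚ.+ B) ℚ.* (x ℚ.* y))) (inv!-suc t) ⟩
  sign t ℚ.* ((A ℚ.* x) ℚ.* y) ℚ.+ (ℚ.- sign t) ℚ.* ((A ℚ.+ B) ℚ.* (x ℚ.* y))
    ≡⟨ solve 5 (λ A B σ x y → σ :* ((A :* x) :* y) :+ (:- σ) :* ((A :+ B) :* (x :* y)) := (:- σ) :* (x :* (B :* y)))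
               refl A B (sign t) x y ⟩
  (ℚ.- sign t) ℚ.* (x ℚ.* (B ℚ.* y))
    ≡⟨ cong (λ z → (ℚ.- sign t) ℚ.* (x ℚ.* z)) (inv!-suc u) ⟨
  (ℚ.- sign t) ℚ.* (x ℚ.* inv! u) ∎
  where
  open ≡-Reasoning
  s = suc (suc (t + u))
  P = binomialAlternatingSum s t
  A = ι (suc t)
  B = ι (suc u)
  x = inv! (suc t)
  y = inv! (suc u)
  s∸[1+t]≡1+u : s ∸ suc t ≡ suc u
  s∸[1+t]≡1+u = trans (cong (_∸ t) (sym (ℕP.+-suc t u))) (ℕP.m+n∸m≡n t (suc u))
  ιs≡A+B : ι s ≡ A ℚ.+ B
  ιs≡A+B = trans (cong (ι ∘ suc) (sym (ℕP.+-suc t u))) (ι-+ (suc t) (suc u))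
  IH : ι s ℚ.* P ≡ sign t ℚ.* (inv! t ℚ.* y)
  IH = subst (λ w → ι (suc w) ℚ.* binomialAlternatingSum (suc w) t ≡ sign t ℚ.* (inv! t ℚ.* y))
             (ℕP.+-suc t u) (binomialAlternatingSum-partial t (suc u))

ι[1+n]*q≡0⇒q≡0 : ∀ n {q} → ι (suc n) ℚ.* q ≡ 0ℚ → q ≡ 0ℚ
ι[1+n]*q≡0⇒q≡0 n {q} ιq≡0 = begin
  q                                                   ≡⟨ ℚP.*-identityʳ q ⟨
  q ℚ.* 1ℚ                                            ≡⟨ cong (q ℚ.*_) (inv!-*-! n) ⟨
  q ℚ.* (inv! n ℚ.* ι (n !))                          ≡⟨ cong (λ z → q ℚ.* (z ℚ.* ι (n !))) (inv!-suc n) ⟩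
  q ℚ.* ((ι (suc n) ℚ.* inv! (suc n)) ℚ.* ι (n !))   ≡⟨ solve 4 (λ q a b c → q :* ((a :* b) :* c) := (a :* q) :* (b :* c))
                                                                  refl q (ι (suc n)) (inv! (suc n)) (ι (n !)) ⟩
  (ι (suc n) ℚ.* q) ℚ.* (inv! (suc n) ℚ.* ι (n !))   ≡⟨ cong (ℚ._* (inv! (suc n) ℚ.* ι (n !))) ιq≡0 ⟩
  0ℚ ℚ.* (inv! (suc n) ℚ.* ι (n !))                  ≡⟨ ℚP.*-zeroˡ (inv! (suc n) ℚ.* ι (n !)) ⟩
  0ℚ                                                  ∎
  where open ≡-Reasoning

binomialAlternatingSum-full : ∀ u → binomialAlternatingSum (suc u) (suc u) ≡ 0ℚ
binomialAlternatingSum-full u = ι[1+n]*q≡0⇒q≡0 u (begin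
  ι (suc u) ℚ.* (P ℚ.+ (ℚ.- sign u) ℚ.* (inv! (suc u) ℚ.* inv! (u ∸ u)))
    ≡⟨ cong (λ k → ι (suc u) ℚ.* (P ℚ.+ (ℚ.- sign u) ℚ.* (inv! (suc u) ℚ.* inv! k))) (ℕP.n∸n≡0 u) ⟩
  ι (suc u) ℚ.* (P ℚ.+ (ℚ.- sign u) ℚ.* (inv! (suc u) ℚ.* inv! 0))
    ≡⟨ solve 5 (λ a P σ x y → a :* (P :+ (:- σ) :* (x :* y)) := a :* P :+ (:- σ) :* ((a :* x) :* y))
               refl (ι (suc u)) P (sign u) (inv! (suc u)) (inv! 0) ⟩
  ι (suc u) ℚ.* P ℚ.+ (ℚ.- sign u) ℚ.* ((ι (suc u) ℚ.* inv! (suc u)) ℚ.* inv! 0)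
    ≡⟨ cong₂ (λ z w → z ℚ.+ (ℚ.- sign u) ℚ.* (w ℚ.* inv! 0)) partial (sym (inv!-suc u)) ⟩
  sign u ℚ.* (inv! u ℚ.* inv! 0) ℚ.+ (ℚ.- sign u) ℚ.* (inv! u ℚ.* inv! 0)
    ≡⟨ solve 2 (λ σ z → σ :* z :+ (:- σ) :* z := con 0ℚ) refl (sign u) (inv! u ℚ.* inv! 0) ⟩
  0ℚ ∎)
  where
  open ≡-Reasoning
  P = binomialAlternatingSum (suc u) u
  partial : ι (suc u) ℚ.* P ≡ sign u ℚ.* (inv! u ℚ.* inv! 0)
  partial = subst (λ w → ι (suc w) ℚ.* binomialAlternatingSum (suc w) u ≡ sign u ℚ.* (inv! u ℚ.* inv! 0))
                  (ℕP.+-identityʳ u) (binomialAlternatingSum-partial u 0)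

-- Σ_{i + j ≤ M} (-1)^i / (i! j!), a truncated Cauchy product of the series of 1/e and e
cauchyProduct : ℕ → ℚ
cauchyProduct M = ∑ (suc M) (λ j → e⁻¹Partial (suc M ∸ j) ℚ.* inv! j)

-- Raising M adds the terms with i + j = M + 1, which sum to 0 by the binomial theorem.
cauchyProduct≡1 : ∀ M → cauchyProduct M ≡ 1ℚ
cauchyProduct≡1 zero    = trans (ℚP.+-identityˡ _) (trans (cong₂ ℚ._*_ e⁻¹Partial-1 inv!-0) (ℚP.*-identityˡ 1ℚ))
cauchyProduct≡1 (suc M) = begin
  ∑ (suc (suc M)) (λ j → F (suc (suc M) ∸ j) ℚ.* inv! j)
    ≡⟨ ∑-cong (suc (suc M)) split ⟩
  ∑ (suc (suc M)) (λ j → F (suc M ∸ j) ℚ.* inv! j ℚ.+ σ ℚ.* b j)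
    ≡⟨ ∑-+ (suc (suc M)) _ _ ⟩
  ∑ (suc (suc M)) (λ j → F (suc M ∸ j) ℚ.* inv! j) ℚ.+ ∑ (suc (suc M)) (λ j → σ ℚ.* b j)
    ≡⟨ cong (∑ (suc (suc M)) (λ j → F (suc M ∸ j) ℚ.* inv! j) ℚ.+_) (∑-*ˡ (suc (suc M)) σ b) ⟩
  (cauchyProduct M ℚ.+ F (M ∸ M) ℚ.* inv! (suc M)) ℚ.+ σ ℚ.* binomialAlternatingSum (suc M) (suc M)
    ≡⟨ cong₂ (λ k z → (cauchyProduct M ℚ.+ F k ℚ.* inv! (suc M)) ℚ.+ σ ℚ.* z)
             (ℕP.n∸n≡0 M) (binomialAlternatingSum-full M) ⟩
  (cauchyProduct M ℚ.+ 0ℚ ℚ.* inv! (suc M)) ℚ.+ σ ℚ.* 0ℚ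
    ≡⟨ solve 3 (λ c a σ → (c :+ con 0ℚ :* a) :+ σ :* con 0ℚ := c) refl (cauchyProduct M) (inv! (suc M)) σ ⟩
  cauchyProduct M
    ≡⟨ cauchyProduct≡1 M ⟩
  1ℚ ∎
  where
  open ≡-Reasoning
  F = e⁻¹Partial
  σ = sign (suc M)
  b : ℕ → ℚ
  b j = sign j ℚ.* (inv! j ℚ.* inv! (suc M ∸ j))
  split : ∀ {j} → j < suc (suc M) → F (suc (suc M) ∸ j) ℚ.* inv! j ≡ F (suc M ∸ j) ℚ.* inv! j ℚ.+ σ ℚ.* b j
  split {j} (s≤s j≤1+M) = begin
    F (suc (suc M) ∸ j) ℚ.* inv! j
      ≡⟨ cong (λ k → F k ℚ.* inv! j) (ℕP.+-∸-assoc 1 j≤1+M) ⟩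
    (F (suc M ∸ j) ℚ.+ sign (suc M ∸ j) ℚ.* inv! (suc M ∸ j)) ℚ.* inv! j
      ≡⟨ cong (λ z → (F (suc M ∸ j) ℚ.+ z ℚ.* inv! (suc M ∸ j)) ℚ.* inv! j) (sign-∸ j≤1+M) ⟩
    (F (suc M ∸ j) ℚ.+ (σ ℚ.* sign j) ℚ.* inv! (suc M ∸ j)) ℚ.* inv! j
      ≡⟨ solve 5 (λ f s t a b → (f :+ (s :* t) :* a) :* b := f :* b :+ s :* (t :* (b :* a)))
               refl (F (suc M ∸ j)) σ (sign j) (inv! (suc M ∸ j)) (inv! j) ⟩
    F (suc M ∸ j) ℚ.* inv! j ℚ.+ σ ℚ.* b j ∎

0≤p*q : ∀ {p q} → 0ℚ ℚ.≤ p → 0ℚ ℚ.≤ q → 0ℚ ℚ.≤ p ℚ.* q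
0≤p*q {p} {q} 0≤p 0≤q = subst (ℚ._≤ p ℚ.* q) (ℚP.*-zeroˡ q) (ℚP.*-monoʳ-≤-nonNeg q {{ℚ.nonNegative 0≤q}} 0≤p)

-- The even partial sum e⁻¹Partial (2h) bounds the first n coefficients of the Cauchy product from below.
e⁻¹Partial-even*ePartial≤1 : ∀ h n → e⁻¹Partial (2 * h) ℚ.* ∑ n inv! ℚ.≤ 1ℚ
e⁻¹Partial-even*ePartial≤1 h n = begin
  F m ℚ.* ∑ n inv!                 ≡⟨ ∑-*ˡ n (F m) inv! ⟨
  ∑ n (λ j → F m ℚ.* inv! j)       ≤⟨ ∑-mono-≤ n term≤ ⟩
  ∑ n f                            ≤⟨ ∑-mono-length (λ j → 0≤p*q (e⁻¹Partial-nonNeg (suc M ∸ j)) (inv!-nonNeg j))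
                                                    (ℕP.≤-trans (ℕP.m≤n+m n m) (ℕP.n≤1+n M)) ⟩
  cauchyProduct M                  ≡⟨ cauchyProduct≡1 M ⟩
  1ℚ                               ∎
  where
  open ℚP.≤-Reasoning
  F = e⁻¹Partial
  m = 2 * h
  M = m + n
  f = λ j → F (suc M ∸ j) ℚ.* inv! j
  term≤ : ∀ {j} → j < n → F m ℚ.* inv! j ℚ.≤ f j
  term≤ {j} j<n = ℚP.*-monoʳ-≤-nonNeg (inv! j) {{ℚ.nonNegative (inv!-nonNeg j)}}
    (e⁻¹Partial-even≤ h (ℕP.m+n≤o⇒m≤o∸n m (ℕP.≤-trans (ℕP.+-monoʳ-≤ m (ℕP.<⇒≤ j<n)) (ℕP.n≤1+n M))))

ι-2 : ι 2 ≡ 1ℚ ℚ.+ 1ℚ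
ι-2 = trans (ι-+ 1 1) (cong₂ ℚ._+_ ι-1 ι-1)

2*inv![1+k]≤inv![k] : ∀ {k} → 1 ≤ k → inv! (suc k) ℚ.+ inv! (suc k) ℚ.≤ inv! k
2*inv![1+k]≤inv![k] {k} 1≤k = begin
  y ℚ.+ y             ≡⟨ solve 1 (λ y → y :+ y := (con 1ℚ :+ con 1ℚ) :* y) refl y ⟩
  (1ℚ ℚ.+ 1ℚ) ℚ.* y   ≡⟨ cong (ℚ._* y) ι-2 ⟨
  ι 2 ℚ.* y           ≤⟨ ℚP.*-monoʳ-≤-nonNeg y {{ℚ.nonNegative (inv!-nonNeg (suc k))}} (ι-mono-≤ (s≤s 1≤k)) ⟩
  ι (suc k) ℚ.* y     ≡⟨ inv!-suc k ⟨
  inv! k              ∎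
  where
  open ℚP.≤-Reasoning
  y = inv! (suc k)

-- Carrying the doubled last term makes the bound inductive in L.
∑-inv!-tail : ∀ a L → ∑ L (λ i → inv! (suc a + i)) ℚ.+ (inv! (suc a + L) ℚ.+ inv! (suc a + L))
                      ℚ.≤ inv! (suc a) ℚ.+ inv! (suc a)
∑-inv!-tail a zero = ℚP.≤-reflexive
  (trans (ℚP.+-identityˡ _) (cong (λ k → inv! (suc k) ℚ.+ inv! (suc k)) (ℕP.+-identityʳ a)))
∑-inv!-tail a (suc L) = begin
  (S ℚ.+ inv! k) ℚ.+ (inv! (suc a + suc L) ℚ.+ inv! (suc a + suc L))
    ≡⟨ cong (λ i → (S ℚ.+ inv! k) ℚ.+ (inv! i ℚ.+ inv! i)) (ℕP.+-suc (suc a) L) ⟩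
  (S ℚ.+ inv! k) ℚ.+ (inv! (suc k) ℚ.+ inv! (suc k))
    ≡⟨ ℚP.+-assoc S (inv! k) (inv! (suc k) ℚ.+ inv! (suc k)) ⟩
  S ℚ.+ (inv! k ℚ.+ (inv! (suc k) ℚ.+ inv! (suc k)))
    ≤⟨ ℚP.+-monoʳ-≤ S (ℚP.+-monoʳ-≤ (inv! k) (2*inv![1+k]≤inv![k] (s≤s z≤n))) ⟩
  S ℚ.+ (inv! k ℚ.+ inv! k)
    ≤⟨ ∑-inv!-tail a L ⟩
  inv! (suc a) ℚ.+ inv! (suc a) ∎
  where
  open ℚP.≤-Reasoning
  S = ∑ L (λ i → inv! (suc a + i))
  k = suc a + L

inv!-gap : ∀ m → let ρ = inv! (3 + m) in ρ ℚ.+ ρ ℚ.< inv! (1 + m) ℚ.- inv! (2 + m)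
inv!-gap m = begin-strict
  ρ ℚ.+ ρ                                  ≡⟨ solve 1 (λ ρ → ρ :+ ρ := (con 1ℚ :+ con 1ℚ) :* ρ) refl ρ ⟩
  (1ℚ ℚ.+ 1ℚ) ℚ.* ρ                        ≡⟨ cong (ℚ._* ρ) ι-2 ⟨
  ι 2 ℚ.* ρ                                <⟨ ℚP.*-monoˡ-<-pos ρ {{ℚ.positive (inv!-pos (3 + m))}} (ι-mono-< (s≤s (s≤s (s≤s z≤n)))) ⟩
  ι ((1 + m) * (3 + m)) ℚ.* ρ        ≡⟨ cong (ℚ._* ρ) (ι-* (1 + m) (3 + m)) ⟩
  (ι (1 + m) ℚ.* ι (3 + m)) ℚ.* ρ     ≡⟨ ℚP.*-assoc (ι (1 + m)) (ι (3 + m)) ρ ⟩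
  ι (1 + m) ℚ.* (ι (3 + m) ℚ.* ρ)     ≡⟨ cong (ι (1 + m) ℚ.*_) (inv!-suc (2 + m)) ⟨
  ι (1 + m) ℚ.* y                        ≡⟨ solve 2 (λ a y → a :* y := (con 1ℚ :+ a) :* y :- y) refl (ι (1 + m)) y ⟩
  (1ℚ ℚ.+ ι (1 + m)) ℚ.* y ℚ.- y         ≡⟨ cong (λ z → z ℚ.* y ℚ.- y) (trans (ι-+ 1 (1 + m)) (cong (ℚ._+ ι (1 + m)) ι-1)) ⟨
  ι (2 + m) ℚ.* y ℚ.- y                  ≡⟨ cong (ℚ._- y) (inv!-suc (1 + m)) ⟨
  inv! (1 + m) ℚ.- y                     ∎
  where
  open ℚP.≤-Reasoning
  ρ = inv! (3 + m)
  y = inv! (2 + m)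

∑-inv!-tail≤ : ∀ a L → ∑ L (λ i → inv! (suc a + i)) ℚ.≤ inv! (suc a) ℚ.+ inv! (suc a)
∑-inv!-tail≤ a L =
  ℚP.≤-trans (p≤p+q _ (ℚP.+-mono-≤ (inv!-nonNeg (suc a + L)) (inv!-nonNeg (suc a + L)))) (∑-inv!-tail a L)

1≤ePartial : ∀ {n} → 1 ≤ n → 1ℚ ℚ.≤ ∑ n inv!
1≤ePartial {n} 1≤n = subst (ℚ._≤ ∑ n inv!) (trans (ℚP.+-identityˡ (inv! 0)) inv!-0) (∑-mono-length inv!-nonNeg 1≤n)

e⁻¹Partial-odd-step : ∀ h → let m = 2 * h in
                      e⁻¹Partial (1 + m) ≡ e⁻¹Partial (3 + m) ℚ.+ (inv! (1 + m) ℚ.- inv! (2 + m))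
e⁻¹Partial-odd-step h = begin
  F (1 + m)                                     ≡⟨ solve 2 (λ x d → x := (x :+ (:- con 1ℚ) :* d) :+ d) refl (F (1 + m)) D ⟩
  (F (1 + m) ℚ.+ (ℚ.- 1ℚ) ℚ.* D) ℚ.+ D          ≡⟨ cong (λ σ → (F (1 + m) ℚ.+ (ℚ.- σ) ℚ.* D) ℚ.+ D) (sign-even h) ⟨
  (F (1 + m) ℚ.+ sign (1 + m) ℚ.* D) ℚ.+ D      ≡⟨ cong (ℚ._+ D) (e⁻¹Partial-suc-suc (1 + m)) ⟨
  F (3 + m) ℚ.+ D                               ∎
  where
  open ≡-Reasoning
  F = e⁻¹Partial
  m = 2 * h
  D = inv! (1 + m) ℚ.- inv! (2 + m)

-- Split at j = m + 2: below, the coefficients are at most e⁻¹Partial (m + 3); above, at most 1.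
cauchyProduct-split≤ : ∀ h → let m = 2 * h; ρ = inv! (3 + m) in
  cauchyProduct (2 + m + m) ℚ.≤
  (e⁻¹Partial (3 + m) ℚ.* ∑ (2 + m) inv! ℚ.+ e⁻¹Partial (1 + m) ℚ.* inv! (2 + m)) ℚ.+ (ρ ℚ.+ ρ)
cauchyProduct-split≤ h = begin
  ∑ (3 + m + m) f                                     ≡⟨ ∑-+-length (3 + m) m f ⟩
  (∑ (2 + m) f ℚ.+ f (2 + m)) ℚ.+ ∑ m (λ i → f (3 + m + i))
    ≤⟨ ℚP.+-mono-≤ (ℚP.+-mono-≤ head≤ (ℚP.≤-reflexive middle≡)) tail≤ ⟩
  (F (3 + m) ℚ.* ∑ (2 + m) inv! ℚ.+ F (1 + m) ℚ.* inv! (2 + m)) ℚ.+ (ρ ℚ.+ ρ) ∎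
  where
  open ℚP.≤-Reasoning
  F = e⁻¹Partial
  m = 2 * h
  ρ = inv! (3 + m)
  f = λ j → F (3 + m + m ∸ j) ℚ.* inv! j

  2+m≤ : ∀ {j} → j ≤ 1 + m → 2 * suc h ≤ 3 + m + m ∸ j
  2+m≤ {j} j≤1+m = subst (_≤ 3 + m + m ∸ j) (sym (ℕP.*-suc 2 h))
    (ℕP.m+n≤o⇒m≤o∸n (2 + m) (ℕP.≤-trans (ℕP.+-monoʳ-≤ (2 + m) j≤1+m) (ℕP.≤-reflexive (ℕP.+-suc (2 + m) m))))

  head≤ : ∑ (2 + m) f ℚ.≤ F (3 + m) ℚ.* ∑ (2 + m) inv!
  head≤ = ℚP.≤-trans (∑-mono-≤ (2 + m) term≤) (ℚP.≤-reflexive (∑-*ˡ (2 + m) (F (3 + m)) inv!))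
    where
    term≤ : ∀ {j} → j < 2 + m → f j ℚ.≤ F (3 + m) ℚ.* inv! j
    term≤ {j} (s≤s j≤1+m) = ℚP.*-monoʳ-≤-nonNeg (inv! j) {{ℚ.nonNegative (inv!-nonNeg j)}}
      (subst (λ k → F (3 + m + m ∸ j) ℚ.≤ F (suc k)) (ℕP.*-suc 2 h) (e⁻¹Partial≤odd (suc h) (2+m≤ j≤1+m)))

  middle≡ : f (2 + m) ≡ F (1 + m) ℚ.* inv! (2 + m)
  middle≡ = cong (λ k → F k ℚ.* inv! (2 + m))
    (trans (cong (_∸ (2 + m)) (sym (ℕP.+-suc (2 + m) m))) (ℕP.m+n∸m≡n (2 + m) (1 + m)))

  tail≤ : ∑ m (λ i → f (3 + m + i)) ℚ.≤ ρ ℚ.+ ρ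
  tail≤ = ℚP.≤-trans (∑-mono-≤ m (λ {i} _ → term≤ i)) (∑-inv!-tail≤ (2 + m) m)
    where
    term≤ : ∀ i → f (3 + m + i) ℚ.≤ inv! (3 + m + i)
    term≤ i = ℚP.≤-trans (ℚP.*-monoʳ-≤-nonNeg (inv! (3 + m + i)) {{ℚ.nonNegative (inv!-nonNeg (3 + m + i))}}
                            (e⁻¹Partial≤1 (3 + m + m ∸ (3 + m + i))))
                         (ℚP.≤-reflexive (ℚP.*-identityˡ (inv! (3 + m + i))))

-- The tail 2/(m+3)! of the split is beaten by e⁻¹Partial (m + 1) - e⁻¹Partial (m + 3) = 1/(m+1)! - 1/(m+2)!.
1<e⁻¹Partial-odd*ePartial : ∀ h → 1ℚ ℚ.< e⁻¹Partial (suc (2 * h)) ℚ.* ∑ (3 + 2 * h) inv!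
1<e⁻¹Partial-odd*ePartial h = begin-strict
  1ℚ                                               ≡⟨ cauchyProduct≡1 (2 + m + m) ⟨
  cauchyProduct (2 + m + m)                        ≤⟨ cauchyProduct-split≤ h ⟩
  (F (3 + m) ℚ.* E ℚ.+ F (1 + m) ℚ.* inv! (2 + m)) ℚ.+ (ρ ℚ.+ ρ)
    ≡⟨ solve 4 (λ x y z w → (x :+ y) :+ (z :+ w) := (x :+ (z :+ w)) :+ y)
               refl (F (3 + m) ℚ.* E) (F (1 + m) ℚ.* inv! (2 + m)) ρ ρ ⟩
  (F (3 + m) ℚ.* E ℚ.+ (ρ ℚ.+ ρ)) ℚ.+ F (1 + m) ℚ.* inv! (2 + m)
    <⟨ ℚP.+-monoˡ-< (F (1 + m) ℚ.* inv! (2 + m)) (ℚP.+-monoʳ-< (F (3 + m) ℚ.* E) (inv!-gap m)) ⟩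
  (F (3 + m) ℚ.* E ℚ.+ D) ℚ.+ F (1 + m) ℚ.* inv! (2 + m)
    ≤⟨ ℚP.+-monoˡ-≤ (F (1 + m) ℚ.* inv! (2 + m)) (ℚP.+-monoʳ-≤ (F (3 + m) ℚ.* E) D≤D*E) ⟩
  (F (3 + m) ℚ.* E ℚ.+ D ℚ.* E) ℚ.+ F (1 + m) ℚ.* inv! (2 + m)
    ≡⟨ cong (ℚ._+ F (1 + m) ℚ.* inv! (2 + m))
            (trans (cong (ℚ._* E) (e⁻¹Partial-odd-step h)) (ℚP.*-distribʳ-+ E (F (3 + m)) D)) ⟨
  F (1 + m) ℚ.* E ℚ.+ F (1 + m) ℚ.* inv! (2 + m)  ≡⟨ ℚP.*-distribˡ-+ (F (1 + m)) E (inv! (2 + m)) ⟨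
  F (1 + m) ℚ.* ∑ (3 + m) inv!                     ∎
  where
  open ℚP.≤-Reasoning
  F = e⁻¹Partial
  m = 2 * h
  E = ∑ (2 + m) inv!
  ρ = inv! (3 + m)
  D = inv! (1 + m) ℚ.- inv! (2 + m)
  D≤D*E : D ℚ.≤ D ℚ.* E
  D≤D*E = subst (ℚ._≤ D ℚ.* E) (ℚP.*-identityʳ D)
            (ℚP.*-monoˡ-≤-nonNeg D {{ℚ.nonNegative 0≤D}} (1≤ePartial {2 + m} (s≤s z≤n)))
    where
    0≤D : 0ℚ ℚ.≤ D
    0≤D = ℚP.<⇒≤ (ℚP.≤-<-trans (ℚP.+-mono-≤ (inv!-nonNeg (3 + m)) (inv!-nonNeg (3 + m))) (inv!-gap m))

ι!*e⁻¹Partial-suc : ∀ n → ι (suc n !) ℚ.* e⁻¹Partial (suc (suc n))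
                          ≡ ι (suc n) ℚ.* (ι (n !) ℚ.* e⁻¹Partial (suc n)) ℚ.+ sign (suc n)
ι!*e⁻¹Partial-suc n = begin
  ι (suc n * n !) ℚ.* (F ℚ.+ σ ℚ.* inv! (suc n))             ≡⟨ cong (ℚ._* (F ℚ.+ σ ℚ.* inv! (suc n))) (ι-* (suc n) (n !)) ⟩
  (N ℚ.* ι (n !)) ℚ.* (F ℚ.+ σ ℚ.* inv! (suc n))              ≡⟨ solve 5 (λ N f F σ r → (N :* f) :* (F :+ σ :* r) :=
                                                                          N :* (f :* F) :+ σ :* (r :* (N :* f)))
                                                                       refl N (ι (n !)) F σ (inv! (suc n)) ⟩
  N ℚ.* (ι (n !) ℚ.* F) ℚ.+ σ ℚ.* (inv! (suc n) ℚ.* (N ℚ.* ι (n !)))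
    ≡⟨ cong (λ z → N ℚ.* (ι (n !) ℚ.* F) ℚ.+ σ ℚ.* (inv! (suc n) ℚ.* z)) (ι-* (suc n) (n !)) ⟨
  N ℚ.* (ι (n !) ℚ.* F) ℚ.+ σ ℚ.* (inv! (suc n) ℚ.* ι (suc n !))
    ≡⟨ cong (λ z → N ℚ.* (ι (n !) ℚ.* F) ℚ.+ σ ℚ.* z) (inv!-*-! (suc n)) ⟩
  N ℚ.* (ι (n !) ℚ.* F) ℚ.+ σ ℚ.* 1ℚ                          ≡⟨ cong (N ℚ.* (ι (n !) ℚ.* F) ℚ.+_) (ℚP.*-identityʳ σ) ⟩
  N ℚ.* (ι (n !) ℚ.* F) ℚ.+ σ                                  ∎
  where
  open ≡-Reasoning
  N = ι (suc n)
  F = e⁻¹Partial (suc n)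
  σ = sign (suc n)

-- n! Σ_{i ≤ n} (-1)^i / i! satisfies the recurrence of the derangement numbers.
derangements-ℚ : ∀ n → ι (derangements n) ≡ ι (n !) ℚ.* e⁻¹Partial (suc n)
derangements-ℚ zero = trans ι-1 (sym (trans (cong₂ ℚ._*_ ι-1 e⁻¹Partial-1) (ℚP.*-identityˡ 1ℚ)))
derangements-ℚ (suc zero) = trans ι-0 (sym (begin
  ι 1 ℚ.* e⁻¹Partial 2                       ≡⟨ ι!*e⁻¹Partial-suc 0 ⟩
  ι 1 ℚ.* (ι 1 ℚ.* e⁻¹Partial 1) ℚ.+ sign 1  ≡⟨ cong₂ (λ a b → a ℚ.* (a ℚ.* b) ℚ.+ sign 1) ι-1 e⁻¹Partial-1 ⟩
  1ℚ ℚ.* (1ℚ ℚ.* 1ℚ) ℚ.+ ℚ.- 1ℚ             ≡⟨⟩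
  0ℚ                                         ∎))
  where open ≡-Reasoning
derangements-ℚ (suc (suc n)) = begin
  ι (suc n * (derangements (suc n) + derangements n))
    ≡⟨ trans (ι-* (suc n) _) (cong (N ℚ.*_) (ι-+ (derangements (suc n)) (derangements n))) ⟩
  N ℚ.* (ι (derangements (suc n)) ℚ.+ ι (derangements n))
    ≡⟨ cong₂ (λ a b → N ℚ.* (a ℚ.+ b)) (derangements-ℚ (suc n)) (derangements-ℚ n) ⟩
  N ℚ.* (G₁ ℚ.+ G₀)                            ≡⟨ cong (λ g → N ℚ.* (g ℚ.+ G₀)) (ι!*e⁻¹Partial-suc n) ⟩
  N ℚ.* ((N ℚ.* G₀ ℚ.+ σ) ℚ.+ G₀)              ≡⟨ solve 3 (λ N g σ → N :* ((N :* g :+ σ) :+ g) :=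
                                                                 (con 1ℚ :+ N) :* (N :* g :+ σ) :+ (:- σ)) refl N G₀ σ ⟩
  (1ℚ ℚ.+ N) ℚ.* (N ℚ.* G₀ ℚ.+ σ) ℚ.+ ℚ.- σ    ≡⟨ cong (λ g → (1ℚ ℚ.+ N) ℚ.* g ℚ.+ ℚ.- σ) (ι!*e⁻¹Partial-suc n) ⟨
  (1ℚ ℚ.+ N) ℚ.* G₁ ℚ.+ ℚ.- σ                  ≡⟨ cong (λ a → a ℚ.* G₁ ℚ.+ ℚ.- σ) (trans (ι-+ 1 (suc n)) (cong (ℚ._+ N) ι-1)) ⟨
  ι (suc (suc n)) ℚ.* G₁ ℚ.+ sign (suc (suc n)) ≡⟨ ι!*e⁻¹Partial-suc (suc n) ⟨
  ι (suc (suc n) !) ℚ.* e⁻¹Partial (suc (suc (suc n))) ∎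
  where
  open ≡-Reasoning
  N = ι (suc n)
  σ = sign (suc n)
  G₀ = ι (n !) ℚ.* e⁻¹Partial (suc n)
  G₁ = ι (suc n !) ℚ.* e⁻¹Partial (suc (suc n))

derangements-even-ℚ : ∀ h → let a = 2 * h in
                      ι (derangements a) ≡ ι (a !) ℚ.* e⁻¹Partial a ℚ.+ 1ℚ
derangements-even-ℚ h = begin
  ι (derangements a)                                 ≡⟨ derangements-ℚ a ⟩
  ι (a !) ℚ.* (e⁻¹Partial a ℚ.+ sign a ℚ.* inv! a)   ≡⟨ cong (λ σ → ι (a !) ℚ.* (e⁻¹Partial a ℚ.+ σ ℚ.* inv! a)) (sign-even h) ⟩
  ι (a !) ℚ.* (e⁻¹Partial a ℚ.+ 1ℚ ℚ.* inv! a)       ≡⟨ solve 3 (λ N F r → N :* (F :+ con 1ℚ :* r) := N :* F :+ r :* N)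
                                                              refl (ι (a !)) (e⁻¹Partial a) (inv! a) ⟩
  ι (a !) ℚ.* e⁻¹Partial a ℚ.+ inv! a ℚ.* ι (a !)    ≡⟨ cong (ι (a !) ℚ.* e⁻¹Partial a ℚ.+_) (inv!-*-! a) ⟩
  ι (a !) ℚ.* e⁻¹Partial a ℚ.+ 1ℚ                    ∎
  where
  open ≡-Reasoning
  a = 2 * h

IsFloorDivE-intro : ∀ {N k} n₀ → (∀ n → ι k ℚ.* ∑ n inv! ℚ.≤ ι N) → ι N ℚ.< ι (suc k) ℚ.* ∑ n₀ inv! →
                    IsFloorDivE N k
IsFloorDivE-intro {N} {k} n₀ below above =
  (λ n → subst₂ ℚ._≤_ (sym (cong₂ ℚ._*_ (/1≡ι k) (ePartial≡∑inv! n))) (sym (/1≡ι N)) (below n)) ,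
  (n₀ , subst₂ ℚ._<_ (sym (/1≡ι N)) (sym (cong₂ ℚ._*_ (/1≡ι (suc k)) (ePartial≡∑inv! n₀))) above)

-- The two floor bounds are the Cauchy product estimates scaled by (2h)!.
floor[!/e]≡derangements-1 : ∀ h → ∃[ k ] suc k ≡ derangements (2 * h) × IsFloorDivE ((2 * h) !) k
floor[!/e]≡derangements-1 h = floor (derangements a) (derangements-ℚ a) (derangements-even-ℚ h)
  where
  a = 2 * h
  N = ι (a !)
  X = N ℚ.* e⁻¹Partial a
  0<N : 0ℚ ℚ.< N
  0<N = subst (ℚ._< N) ι-0 (ι-mono-< (ℕP.1≤n! a))
  0<X+1 : 0ℚ ℚ.< X ℚ.+ 1ℚ
  0<X+1 = ℚP.<-≤-trans (subst₂ ℚ._<_ ι-0 ι-1 (ι-mono-< (s≤s z≤n)))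
            (subst (ℚ._≤ X ℚ.+ 1ℚ) (ℚP.+-identityˡ 1ℚ) (ℚP.+-monoˡ-≤ 1ℚ (0≤p*q (ℚP.<⇒≤ 0<N) (e⁻¹Partial-nonNeg a))))
  floor : ∀ d → ι d ≡ N ℚ.* e⁻¹Partial (suc a) → ι d ≡ X ℚ.+ 1ℚ → ∃[ k ] suc k ≡ d × IsFloorDivE (a !) k
  floor zero    _ ι0≡X+1 =
    contradiction (ι-cancel-< (subst (ι 0 ℚ.<_) (sym ι0≡X+1) (subst (ℚ._< X ℚ.+ 1ℚ) (sym ι-0) 0<X+1))) (ℕP.<-irrefl refl)
  floor (suc k) ι[1+k]≡N*F ι[1+k]≡X+1 = k , refl , IsFloorDivE-intro (3 + a) below above
    where
    ιk≡X : ι k ≡ X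
    ιk≡X = begin
      ι k                      ≡⟨ solve 1 (λ y → y := (con 1ℚ :+ y) :- con 1ℚ) refl (ι k) ⟩
      (1ℚ ℚ.+ ι k) ℚ.- 1ℚ      ≡⟨ cong (ℚ._- 1ℚ) (trans (cong (ℚ._+ ι k) (sym ι-1)) (sym (ι-+ 1 k))) ⟩
      ι (suc k) ℚ.- 1ℚ         ≡⟨ cong (ℚ._- 1ℚ) ι[1+k]≡X+1 ⟩
      (X ℚ.+ 1ℚ) ℚ.- 1ℚ        ≡⟨ solve 1 (λ x → (x :+ con 1ℚ) :- con 1ℚ := x) refl X ⟩
      X                        ∎
      where open ≡-Reasoning
    below : ∀ n → ι k ℚ.* ∑ n inv! ℚ.≤ N
    below n = begin
      ι k ℚ.* ∑ n inv!                    ≡⟨ cong (ℚ._* ∑ n inv!) ιk≡X ⟩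
      X ℚ.* ∑ n inv!                      ≡⟨ ℚP.*-assoc N (e⁻¹Partial a) (∑ n inv!) ⟩
      N ℚ.* (e⁻¹Partial a ℚ.* ∑ n inv!)   ≤⟨ ℚP.*-monoˡ-≤-nonNeg N {{ℚ.nonNegative (ℚP.<⇒≤ 0<N)}}
                                                                 (e⁻¹Partial-even*ePartial≤1 h n) ⟩
      N ℚ.* 1ℚ                            ≡⟨ ℚP.*-identityʳ N ⟩
      N                                   ∎
      where open ℚP.≤-Reasoning
    above : N ℚ.< ι (suc k) ℚ.* ∑ (3 + a) inv!
    above = begin-strict
      N                                                ≡⟨ ℚP.*-identityʳ N ⟨
      N ℚ.* 1ℚ                                         <⟨ ℚP.*-monoʳ-<-pos N {{ℚ.positive 0<N}} (1<e⁻¹Partial-odd*ePartial h) ⟩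
      N ℚ.* (e⁻¹Partial (suc a) ℚ.* ∑ (3 + a) inv!)    ≡⟨ ℚP.*-assoc N (e⁻¹Partial (suc a)) (∑ (3 + a) inv!) ⟨
      (N ℚ.* e⁻¹Partial (suc a)) ℚ.* ∑ (3 + a) inv!    ≡⟨ cong (ℚ._* ∑ (3 + a) inv!) ι[1+k]≡N*F ⟨
      ι (suc k) ℚ.* ∑ (3 + a) inv!                     ∎
      where open ℚP.≤-Reasoning

IsFloorDivE-≤ : ∀ {N k k′} → IsFloorDivE N k → IsFloorDivE N k′ → k ≤ k′
IsFloorDivE-≤ {N} {k} {k′} (k*ePartial≤N , _) (_ , n , N<[1+k′]*ePartial) =
  ℕ.s≤s⁻¹ (ι-cancel-< (subst₂ ℚ._<_ (/1≡ι k) (/1≡ι (suc k′))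
    (ℚP.*-cancelʳ-<-nonNeg (ePartial n) {{ℚ.nonNegative 0≤ePartial}} (ℚP.≤-<-trans (k*ePartial≤N n) N<[1+k′]*ePartial))))
  where
  0≤ePartial : 0ℚ ℚ.≤ ePartial n
  0≤ePartial = subst (0ℚ ℚ.≤_) (sym (ePartial≡∑inv! n)) (∑-nonNeg n inv!-nonNeg)

IsFloorDivE-unique : ∀ {N k k′} → IsFloorDivE N k → IsFloorDivE N k′ → k ≡ k′
IsFloorDivE-unique {N} floor floor′ = ℕP.≤-antisym (IsFloorDivE-≤ {N} floor floor′) (IsFloorDivE-≤ {N} floor′ floor)

mainTheorem5 : ((n : ℕ) → 2 < n → ¬ (n ∣ leftFactorial n))
               ⇔ ((p : ℕ) → Prime p → 2 < p → (k : ℕ) → IsFloorDivE ((p ∸ 1) !) k → ¬ (p ∣ suc k))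
mainTheorem5 = mk⇔ to from
  where
  to : ((n : ℕ) → 2 < n → ¬ (n ∣ leftFactorial n)) →
       ((p : ℕ) → Prime p → 2 < p → (k : ℕ) → IsFloorDivE ((p ∸ 1) !) k → ¬ (p ∣ suc k))
  to p∤!p p p-prime 2<p k floor p∣1+k with prime>2⇒odd p-prime 2<p
  ... | h , refl = let k′ , 1+k′≡D , floor′ = floor[!/e]≡derangements-1 h in
    p∤!p p 2<p (Equivalence.to (∣derangements⇔∣leftFactorial h)
      (subst (p ∣_) (trans (cong suc (IsFloorDivE-unique {(2 * h) !} floor floor′)) 1+k′≡D) p∣1+k))
  from : ((p : ℕ) → Prime p → 2 < p → (k : ℕ) → IsFloorDivE ((p ∸ 1) !) k → ¬ (p ∣ suc k)) →
         ((n : ℕ) → 2 < n → ¬ (n ∣ leftFactorial n))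
  from p∤1+k n 2<n n∣!n with ∣leftFactorial⇒∃oddPrime n 2<n n∣!n
  ... | p , p-prime , 2<p , p∣!p with prime>2⇒odd p-prime 2<p
  ... | h , refl = let k , 1+k≡D , floor = floor[!/e]≡derangements-1 h in
    p∤1+k p p-prime 2<p k floor (subst (p ∣_) (sym 1+k≡D) (Equivalence.from (∣derangements⇔∣leftFactorial h) p∣!p))
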